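{- Let $L:\mathcal U$ be a $\mathcal V$-sup-lattice with a basis $\beta:B\to L$. Then every family $\alpha:I\to L$ with $I:\mathcal V$ has an infimum (greatest lower bound) in $L$.
   Context: Martin-Löf type theory with universes, function and propositional extensionality, propositional truncations. A type is $\mathcal V$-small if equivalent to a type in $\mathcal V$. A poset is a type $P:\mathcal U$ with a proposition-valued reflexive, antisymmetric, transitive relation $\le:P\to P\to\mathcal W$. A $\mathcal V$-sup-lattice is a poset $L:\mathcal U$ in which every family indexed by a type in $\mathcal V$ has a least upper bound. A basis is a type $B:\mathcal V$ with $\beta:B\to L$ such that (1) for all $b:B$, $x:L$ the type $\beta(b)\le x$ is $\mathcal V$-small, and (2) every $x:L$ is the least upper bound of $\beta\circ\mathrm{pr}_1:(\sum_{b:B}\beta(b)\le x)\to L$. -}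

module Defs where

open import Level using (Level; _⊔_; suc)
open import Data.Product using (Σ; _,_; proj₁; proj₂; _×_)
open import Relation.Binary.PropositionalEquality using (_≡_)
open import Function.Bundles using (_↔_)

is-prop : ∀ {a} → Set a → Set a
is-prop A = (p q : A) → p ≡ q

is-small : ∀ {a} (𝓋 : Level) → Set a → Set (a ⊔ suc 𝓋)
is-small 𝓋 A = Σ (Set 𝓋) (λ X → X ↔ A)

record Poset (𝓊 𝓌 : Level) : Set (suc (𝓊 ⊔ 𝓌)) where
  field
    Carrier   : Set 𝓊
    _≤_       : Carrier → Carrier → Set 𝓌
    ≤-prop    : ∀ x y → is-prop (x ≤ y)
    ≤-refl    : ∀ x → x ≤ x
    ≤-antisym : ∀ {x y} → x ≤ y → y ≤ x → x ≡ y
    ≤-trans   : ∀ {x y z} → x ≤ y → y ≤ z → x ≤ z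

module _ {𝓊 𝓌} (P : Poset 𝓊 𝓌) where
  open Poset P

  is-upper-bound : ∀ {i} {I : Set i} → (I → Carrier) → Carrier → Set (i ⊔ 𝓌)
  is-upper-bound α x = ∀ i → α i ≤ x

  is-lower-bound : ∀ {i} {I : Set i} → (I → Carrier) → Carrier → Set (i ⊔ 𝓌)
  is-lower-bound α x = ∀ i → x ≤ α i

  is-lub : ∀ {i} {I : Set i} → (I → Carrier) → Carrier → Set (𝓊 ⊔ i ⊔ 𝓌)
  is-lub α x = (is-upper-bound α x) ×
               (∀ y → is-upper-bound α y → x ≤ y)

  is-glb : ∀ {i} {I : Set i} → (I → Carrier) → Carrier → Set (𝓊 ⊔ i ⊔ 𝓌)
  is-glb α x = (is-lower-bound α x) ×
               (∀ y → is-lower-bound α y → y ≤ x)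

record SupLattice (𝓊 𝓋 𝓌 : Level) : Set (suc (𝓊 ⊔ 𝓋 ⊔ 𝓌)) where
  field
    poset : Poset 𝓊 𝓌
  open Poset poset public
  field
    sup : ∀ (I : Set 𝓋) (α : I → Carrier) → Σ Carrier (is-lub poset α)

record Basis {𝓊 𝓋 𝓌} (L : SupLattice 𝓊 𝓋 𝓌) : Set (suc 𝓋 ⊔ 𝓊 ⊔ 𝓌) where
  open SupLattice L
  field
    B     : Set 𝓋
    β     : B → Carrier
    small : ∀ b x → is-small 𝓋 (β b ≤ x)
    lub   : ∀ x → is-lub poset {I = Σ B (λ b → β b ≤ x)} (λ p → β (proj₁ p)) x

-- The infimum of α is the join of all basis elements lying below every α i.
-- Smallness of β b ≤ x is what makes this collection indexed by a type in
-- Set 𝓋, so the join exists; and since every element is the join of the basis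
-- elements below it, any lower bound of α lies below that join.
module Submission where

open import Defs
open import Data.Product using (Σ; _,_; proj₁; proj₂)
open import Function using (_∘_)
open import Function.Bundles using (Inverse)

module SupLatticeJoins {𝓊 𝓋 𝓌} (L : SupLattice 𝓊 𝓋 𝓌) where
  open SupLattice L

  ⋁ : {I : Set 𝓋} → (I → Carrier) → Carrier
  ⋁ {I} α = proj₁ (sup I α)

  ⋁-upper : {I : Set 𝓋} (α : I → Carrier) → is-upper-bound poset α (⋁ α)
  ⋁-upper {I} α = proj₁ (proj₂ (sup I α))

  ⋁-least : {I : Set 𝓋} (α : I → Carrier) →
            ∀ y → is-upper-bound poset α y → ⋁ α ≤ y
  ⋁-least {I} α = proj₂ (proj₂ (sup I α))

module BasisInfima {𝓊 𝓋 𝓌} {L : SupLattice 𝓊 𝓋 𝓌} (basis : Basis L) where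
  open SupLattice L
  open SupLatticeJoins L
  open Basis basis

  _≤ᴮ_ : B → Carrier → Set 𝓋
  b ≤ᴮ x = proj₁ (small b x)

  ≤ᴮ⇒≤ : ∀ {b x} → b ≤ᴮ x → β b ≤ x
  ≤ᴮ⇒≤ {b} {x} = Inverse.to (proj₂ (small b x))

  ≤⇒≤ᴮ : ∀ {b x} → β b ≤ x → b ≤ᴮ x
  ≤⇒≤ᴮ {b} {x} = Inverse.from (proj₂ (small b x))

  ≤-from-basis : ∀ {x y} → (∀ b → β b ≤ x → β b ≤ y) → x ≤ y
  ≤-from-basis {x} {y} below = proj₂ (lub x) y (λ (b , βb≤x) → below b βb≤x)

  basic-lower-bounds : {I : Set 𝓋} → (I → Carrier) → Set 𝓋
  basic-lower-bounds α = Σ B (λ b → ∀ i → b ≤ᴮ α i)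

  ⋀ : {I : Set 𝓋} → (I → Carrier) → Carrier
  ⋀ α = ⋁ {I = basic-lower-bounds α} (β ∘ proj₁)

  ⋀-lower : {I : Set 𝓋} (α : I → Carrier) → is-lower-bound poset α (⋀ α)
  ⋀-lower α i = ⋁-least (β ∘ proj₁) (α i) (λ (b , b≤α) → ≤ᴮ⇒≤ (b≤α i))

  ⋀-greatest : {I : Set 𝓋} (α : I → Carrier) →
               ∀ y → is-lower-bound poset α y → y ≤ ⋀ α
  ⋀-greatest α y y≤α = ≤-from-basis λ b βb≤y →
    ⋁-upper (β ∘ proj₁) (b , λ i → ≤⇒≤ᴮ (≤-trans βb≤y (y≤α i)))

  ⋀-is-glb : {I : Set 𝓋} (α : I → Carrier) → is-glb poset α (⋀ α)
  ⋀-is-glb α = ⋀-lower α , ⋀-greatest α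

proposition4p7 : ∀ {𝓊 𝓋 𝓌} (L : SupLattice 𝓊 𝓋 𝓌) → Basis L →
    ∀ (I : Set 𝓋) (α : I → SupLattice.Carrier L) →
    Σ (SupLattice.Carrier L) (is-glb (SupLattice.poset L) α)
proposition4p7 L basis I α = ⋀ α , ⋀-is-glb α
  where open BasisInfima basis
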